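{- Let $n\geq 2$ and let $(a_1,\dots,a_n)$ be positive integers with $a_1\geq\dots\geq a_n$ and $\prod_{i=1}^n a_i=\sum_{i=1}^n a_i$. Then $a_i\leq n$ for all $i$. Moreover, unless $(a_1,\dots,a_n)$ is the basic solution $(n,2,1,\dots,1)$, one has $a_i<n$ for all $i$.
   Context: The basic solution of length $n$ is $a_1=n$, $a_2=2$, $a_3=\dots=a_n=1$. -}

module Defs where

open import Data.Nat using (ℕ; zero; suc; _+_; _*_; _≤_; _<_)
open import Data.Fin using (Fin; zero; suc)
open import Relation.Binary.PropositionalEquality using (_≡_)

-- sum and product of a finite sequence a : Fin n → ℕ  (a zero is a_1)
sumF : ∀ n → (Fin n → ℕ) → ℕ
sumF zero    a = 0
sumF (suc n) a = a zero + sumF n (λ i → a (suc i))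

prodF : ∀ n → (Fin n → ℕ) → ℕ
prodF zero    a = 1
prodF (suc n) a = a zero * prodF n (λ i → a (suc i))

basic : ∀ n → Fin n → ℕ
basic n zero          = n
basic n (suc zero)    = 2
basic n (suc (suc i)) = 1

Decreasing : ∀ n → (Fin n → ℕ) → Set
Decreasing n a = ∀ (i j : Fin n) → Data.Fin._≤_ i j → a j ≤ a i

-- Split off the largest entry x = a₁ and let P, S be the product and sum of the remaining
-- m = n − 1 entries.  For positive integers S − m ≤ P − 1, so the equation x P = x + S,
-- i.e. x (P − 1) = S, gives (x − 1)(P − 1) ≤ m.  Since P ≥ 2 this yields x ≤ m + 1 = n,
-- and x = n forces P = 2, which for a decreasing tail means (2, 1, …, 1).
module Submission where

open import Defs
open import Data.Nat using (ℕ; zero; suc; pred; _+_; _*_; _≤_; _<_; z≤n; s≤s; >-nonZero)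
open import Data.Nat.Properties
open import Data.Fin using (Fin; zero; suc)
open import Data.Product using (_×_; _,_; proj₁; proj₂)
open import Data.Sum using (inj₁; inj₂)
open import Data.Empty using (⊥-elim)
open import Function using (_∘_)
open import Relation.Binary.PropositionalEquality
open import Relation.Nullary using (¬_)

1≤prodF : ∀ m (b : Fin m → ℕ) → (∀ i → 1 ≤ b i) → 1 ≤ prodF m b
1≤prodF zero    b pos = ≤-refl
1≤prodF (suc m) b pos = *-mono-≤ (pos zero) (1≤prodF m (b ∘ suc) (pos ∘ suc))

prodF≤1 : ∀ m (b : Fin m → ℕ) → (∀ i → b i ≤ 1) → prodF m b ≤ 1
prodF≤1 zero    b le = ≤-refl
prodF≤1 (suc m) b le = *-mono-≤ (le zero) (prodF≤1 m (b ∘ suc) (le ∘ suc))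

≤prodF : ∀ m (b : Fin m → ℕ) → (∀ i → 1 ≤ b i) → ∀ i → b i ≤ prodF m b
≤prodF (suc m) b pos zero    = m≤m*n (b zero) _ ⦃ >-nonZero (1≤prodF m (b ∘ suc) (pos ∘ suc)) ⦄
≤prodF (suc m) b pos (suc i) =
  ≤-trans (≤prodF m (b ∘ suc) (pos ∘ suc) i) (m≤n*m _ (b zero) ⦃ >-nonZero (pos zero) ⦄)

length≤sumF : ∀ m (b : Fin m → ℕ) → (∀ i → 1 ≤ b i) → m ≤ sumF m b
length≤sumF zero    b pos = z≤n
length≤sumF (suc m) b pos = +-mono-≤ (pos zero) (length≤sumF m (b ∘ suc) (pos ∘ suc))

-- (c − 1)(d − 1) ≥ 0
+≤*+1 : ∀ {c d} → 1 ≤ c → 1 ≤ d → c + d ≤ c * d + 1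
+≤*+1 {suc c} {suc d} _ _ = begin
  suc c + suc d               ≡⟨ +-suc (suc c) d ⟩
  suc (suc c + d)             ≤⟨ s≤s (+-monoˡ-≤ d (s≤s (m≤m*n c (suc d)))) ⟩
  suc (suc (c * suc d) + d)   ≡⟨ cong suc (+-comm (suc (c * suc d)) d) ⟩
  suc (d + suc (c * suc d))   ≡⟨ cong suc (+-suc d (c * suc d)) ⟩
  suc (suc d + c * suc d)     ≡⟨ +-comm 1 (suc c * suc d) ⟩
  suc c * suc d + 1           ∎
  where open ≤-Reasoning

sumF<prodF+length : ∀ m (b : Fin m → ℕ) → (∀ i → 1 ≤ b i) → sumF m b < prodF m b + m
sumF<prodF+length zero    b pos = ≤-refl
sumF<prodF+length (suc m) b pos = begin-strict
  c + S        <⟨ +-monoʳ-< c (sumF<prodF+length m (b ∘ suc) (pos ∘ suc)) ⟩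
  c + (P + m)  ≡⟨ +-assoc c P m ⟨
  c + P + m    ≤⟨ +-monoˡ-≤ m (+≤*+1 (pos zero) (1≤prodF m (b ∘ suc) (pos ∘ suc))) ⟩
  c * P + 1 + m ≡⟨ +-assoc (c * P) 1 m ⟩
  c * P + suc m ∎
  where
  open ≤-Reasoning
  c = b zero
  P = prodF m (b ∘ suc)
  S = sumF m (b ∘ suc)

decreasing-prodF≡2 : ∀ k (b : Fin (suc k) → ℕ) → (∀ i → 1 ≤ b i) → (∀ i → b i ≤ b zero) →
  prodF (suc k) b ≡ 2 → b zero ≡ 2 × (∀ i → b (suc i) ≡ 1)
decreasing-prodF≡2 k b pos top prod≡2 = b₀≡2 , tail≡1
  where
  b₀≢1 : 1 ≢ b zero
  b₀≢1 1≡b₀ = <⇒≱ (≤-reflexive (sym prod≡2))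
    (prodF≤1 (suc k) b (λ i → subst (b i ≤_) (sym 1≡b₀) (top i)))
  b₀≡2 : b zero ≡ 2
  b₀≡2 = ≤-antisym (≤-trans (≤prodF (suc k) b pos zero) (≤-reflexive prod≡2))
                   (≤∧≢⇒< (pos zero) b₀≢1)
  tailProd≡1 : prodF k (b ∘ suc) ≡ 1
  tailProd≡1 = *-cancelˡ-≡ _ 1 2 (subst (λ c → c * prodF k (b ∘ suc) ≡ 2) b₀≡2 prod≡2)
  tail≡1 : ∀ i → b (suc i) ≡ 1
  tail≡1 i = ≤-antisym (≤-trans (≤prodF k (b ∘ suc) (pos ∘ suc) i) (≤-reflexive tailProd≡1))
                       (pos (suc i))

pred*≤ : ∀ x {p m} → x * p ≤ p + m → pred x * p ≤ m
pred*≤ zero    _  = z≤n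
pred*≤ (suc x) le = +-cancelˡ-≤ _ _ _ le

head-bound : ∀ {x P m S} → 1 ≤ m → 1 ≤ P → m ≤ S → S < P + m → x * P ≡ x + S →
  x ≤ suc m × (x ≡ suc m → P ≡ 2)
head-bound {x} {suc p} {m} {S} 1≤m _ m≤S S<P+m eq = x≤1+m x [x-1]p≤m , x≡1+m⇒P≡2
  where
  xp≡S : x * p ≡ S
  xp≡S = +-cancelˡ-≡ x _ _ (trans (sym (*-suc x p)) eq)
  1≤p : 1 ≤ p
  1≤p = n≢0⇒n>0 λ { refl → <⇒≱ 1≤m (≤-trans m≤S (≤-reflexive (trans (sym xp≡S) (*-zeroʳ x)))) }
  [x-1]p≤m : pred x * p ≤ m
  [x-1]p≤m = pred*≤ x (≤-trans (≤-reflexive xp≡S) (≤-pred S<P+m))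
  x≤1+m : ∀ y → pred y * p ≤ m → y ≤ suc m
  x≤1+m zero    _  = z≤n
  x≤1+m (suc y) le = s≤s (≤-trans (m≤m*n y p ⦃ >-nonZero 1≤p ⦄) le)
  x≡1+m⇒P≡2 : x ≡ suc m → suc p ≡ 2
  x≡1+m⇒P≡2 refl = cong suc (≤-antisym
    (*-cancelˡ-≤ m ⦃ >-nonZero 1≤m ⦄ (≤-trans [x-1]p≤m (≤-reflexive (sym (*-identityʳ m))))) 1≤p)

lemma3p4 : (n : ℕ) → 2 ≤ n → (a : Fin n → ℕ) →
    (∀ i → 1 ≤ a i) → Decreasing n a → prodF n a ≡ sumF n a →
    (∀ i → a i ≤ n) × (¬ (∀ i → a i ≡ basic n i) → ∀ i → a i < n)
lemma3p4 (suc (suc k)) _ a pos dec eq = (λ i → ≤-trans (≤a₀ i) a₀≤n) , a<n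
  where
  b : Fin (suc k) → ℕ
  b = a ∘ suc
  ≤a₀ : ∀ i → a i ≤ a zero
  ≤a₀ i = dec zero i z≤n
  head : a zero ≤ suc (suc k) × (a zero ≡ suc (suc k) → prodF (suc k) b ≡ 2)
  head = head-bound (s≤s z≤n) (1≤prodF _ b (pos ∘ suc)) (length≤sumF _ b (pos ∘ suc))
                    (sumF<prodF+length _ b (pos ∘ suc)) eq
  a₀≤n : a zero ≤ suc (suc k)
  a₀≤n = proj₁ head
  a<n : ¬ (∀ i → a i ≡ basic (suc (suc k)) i) → ∀ i → a i < suc (suc k)
  a<n notBasic i with m≤n⇒m<n∨m≡n a₀≤n
  ... | inj₁ a₀<n = ≤-<-trans (≤a₀ i) a₀<n
  ... | inj₂ a₀≡n = ⊥-elim (notBasic isBasic)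
    where
    tail : a (suc zero) ≡ 2 × (∀ j → a (suc (suc j)) ≡ 1)
    tail = decreasing-prodF≡2 k b (pos ∘ suc) (λ j → dec (suc zero) (suc j) (s≤s z≤n)) (proj₂ head a₀≡n)
    isBasic : ∀ i → a i ≡ basic (suc (suc k)) i
    isBasic zero          = a₀≡n
    isBasic (suc zero)    = proj₁ tail
    isBasic (suc (suc j)) = proj₂ tail j
lemma3p4 (suc zero) (s≤s ()) a pos dec eq
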